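{- A $\mathsf{BST}^{\otimes}$-formula $\Phi$ with $n$ distinct variables is satisfiable if and only if it is satisfied by some partition with $2^{n}-1$ blocks.
   Context: Sets are elements of the von Neumann universe of well-founded sets. For sets $s,t$, $s\otimes t:=\{\{u,v\} : u\in s,\ v\in t\}$. $\mathsf{BST}^{\otimes}$-formulae are propositional combinations of atoms $x=y\cup z$, $x=y\cap z$, $x=y\setminus z$, $x=y\otimes z$, $x\subseteq y$ ($x,y,z$ set variables), interpreted in the usual way under assignments of well-founded sets to the variables; $\Phi$ is satisfiable if some assignment makes it true. A partition is a set of pairwise disjoint nonempty sets (blocks). A partition $\Sigma$ satisfies $\Phi$ if there is a map $\mathfrak{I}:\mathrm{Vars}(\Phi)\to\mathcal{P}(\Sigma)$ (power set) such that the assignment $v\mapsto\bigcup\mathfrak{I}(v)$ makes $\Phi$ true. -}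

module Defs where

open import Data.Nat using (ℕ; _^_; _∸_)
open import Data.Fin using (Fin)
open import Data.Bool using (Bool; true; false; if_then_else_; T)
open import Data.Product using (Σ; _×_; _,_; proj₁)
open import Data.Sum using (_⊎_; inj₁; inj₂)
open import Relation.Nullary using (¬_)
open import Relation.Binary.PropositionalEquality using (_≡_; _≢_)

-- Well-founded sets: Aczel's iterative sets (W-type model of set theory).
-- A set is given by an index type and a family of (hereditarily) sets;
-- equality is extensional bisimilarity.

data V : Set₁ where
  sup : (A : Set) → (A → V) → V

Idx : V → Set
Idx (sup A f) = A

elt : (x : V) → Idx x → V
elt (sup A f) = f

_≐_ : V → V → Set
sup A f ≐ sup B g =
  ((a : A) → Σ B (λ b → f a ≐ g b)) × ((b : B) → Σ A (λ a → f a ≐ g b))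

_∈V_ : V → V → Set
x ∈V y = Σ (Idx y) (λ i → x ≐ elt y i)

_⊆V_ : V → V → Set
x ⊆V y = (i : Idx x) → elt x i ∈V y

_∪V_ : V → V → V
x ∪V y = sup (Idx x ⊎ Idx y) h
  where
  h : Idx x ⊎ Idx y → V
  h (inj₁ i) = elt x i
  h (inj₂ j) = elt y j

_∩V_ : V → V → V
x ∩V y = sup (Σ (Idx x) (λ i → elt x i ∈V y)) (λ p → elt x (proj₁ p))

_∖V_ : V → V → V
x ∖V y = sup (Σ (Idx x) (λ i → ¬ (elt x i ∈V y))) (λ p → elt x (proj₁ p))

upair : V → V → V
upair u v = sup Bool (λ b → if b then u else v)

_⊗V_ : V → V → V
s ⊗V t = sup (Idx s × Idx t) (λ p → upair (elt s (proj₁ p)) (elt t (Data.Product.proj₂ p)))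

data Atom (n : ℕ) : Set where
  ∪-atom : (x y z : Fin n) → Atom n
  ∩-atom : (x y z : Fin n) → Atom n
  ∖-atom : (x y z : Fin n) → Atom n
  ⊗-atom : (x y z : Fin n) → Atom n
  ⊆-atom : (x y : Fin n) → Atom n

data Formula (n : ℕ) : Set where
  atom : Atom n → Formula n
  neg  : Formula n → Formula n
  conj : Formula n → Formula n → Formula n
  disj : Formula n → Formula n → Formula n

data OccursA {n : ℕ} (v : Fin n) : Atom n → Set where
  ∪₁ : ∀ {y z} → OccursA v (∪-atom v y z)
  ∪₂ : ∀ {x z} → OccursA v (∪-atom x v z)
  ∪₃ : ∀ {x y} → OccursA v (∪-atom x y v)
  ∩₁ : ∀ {y z} → OccursA v (∩-atom v y z)
  ∩₂ : ∀ {x z} → OccursA v (∩-atom x v z)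
  ∩₃ : ∀ {x y} → OccursA v (∩-atom x y v)
  ∖₁ : ∀ {y z} → OccursA v (∖-atom v y z)
  ∖₂ : ∀ {x z} → OccursA v (∖-atom x v z)
  ∖₃ : ∀ {x y} → OccursA v (∖-atom x y v)
  ⊗₁ : ∀ {y z} → OccursA v (⊗-atom v y z)
  ⊗₂ : ∀ {x z} → OccursA v (⊗-atom x v z)
  ⊗₃ : ∀ {x y} → OccursA v (⊗-atom x y v)
  ⊆₁ : ∀ {y} → OccursA v (⊆-atom v y)
  ⊆₂ : ∀ {x} → OccursA v (⊆-atom x v)

data Occurs {n : ℕ} (v : Fin n) : Formula n → Set where
  in-atom : ∀ {a} → OccursA v a → Occurs v (atom a)
  in-neg  : ∀ {φ} → Occurs v φ → Occurs v (neg φ)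
  in-conjˡ : ∀ {φ ψ} → Occurs v φ → Occurs v (conj φ ψ)
  in-conjʳ : ∀ {φ ψ} → Occurs v ψ → Occurs v (conj φ ψ)
  in-disjˡ : ∀ {φ ψ} → Occurs v φ → Occurs v (disj φ ψ)
  in-disjʳ : ∀ {φ ψ} → Occurs v ψ → Occurs v (disj φ ψ)

-- Vars(Φ) is exactly the n variables of Fin n
AllVarsOccur : {n : ℕ} → Formula n → Set
AllVarsOccur {n} φ = (v : Fin n) → Occurs v φ

⟦_⟧A : {n : ℕ} → Atom n → (Fin n → V) → Set
⟦ ∪-atom x y z ⟧A M = M x ≐ (M y ∪V M z)
⟦ ∩-atom x y z ⟧A M = M x ≐ (M y ∩V M z)
⟦ ∖-atom x y z ⟧A M = M x ≐ (M y ∖V M z)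
⟦ ⊗-atom x y z ⟧A M = M x ≐ (M y ⊗V M z)
⟦ ⊆-atom x y ⟧A M = M x ⊆V M y

⟦_⟧ : {n : ℕ} → Formula n → (Fin n → V) → Set
⟦ atom a ⟧ M = ⟦ a ⟧A M
⟦ neg φ ⟧ M = ¬ (⟦ φ ⟧ M)
⟦ conj φ ψ ⟧ M = ⟦ φ ⟧ M × ⟦ ψ ⟧ M
⟦ disj φ ψ ⟧ M = ⟦ φ ⟧ M ⊎ ⟦ ψ ⟧ M

Satisfiable : {n : ℕ} → Formula n → Set₁
Satisfiable {n} φ = Σ (Fin n → V) (λ M → ⟦ φ ⟧ M)

-- Partitions with k blocks, given as an enumeration B : Fin k → V of the
-- blocks (the partition is the set Σ = sup (Fin k) B).

Nonempty : V → Set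
Nonempty x = Idx x

Disjoint : V → V → Set
Disjoint x y = (i : Idx x) → ¬ (elt x i ∈V y)

IsPartition : {k : ℕ} → (Fin k → V) → Set
IsPartition {k} B =
  ((b : Fin k) → Nonempty (B b)) ×
  ((b c : Fin k) → b ≢ c → Disjoint (B b) (B c))

blocksSet : {k : ℕ} → (Fin k → V) → V
blocksSet {k} B = sup (Fin k) B

⋃Sub : {k : ℕ} → (Fin k → V) → (Fin k → Bool) → V
⋃Sub {k} B S = sup (Σ (Fin k) (λ b → T (S b) × Idx (B b))) (λ p → elt (B (proj₁ p)) (Data.Product.proj₂ (Data.Product.proj₂ p)))

-- Σ satisfies Φ: some 𝔍 : Vars(Φ) → 𝒫(Σ) with v ↦ ⋃ 𝔍(v) a model of Φ
PartitionSatisfies : {n k : ℕ} → (Fin k → V) → Formula n → Set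
PartitionSatisfies {n} {k} B φ = Σ (Fin n → Fin k → Bool) (λ 𝔍 → ⟦ φ ⟧ (λ v → ⋃Sub B (𝔍 v)))

SatByPartitionOfSize : {n : ℕ} → ℕ → Formula n → Set₁
SatByPartitionOfSize k φ = Σ (Fin k → V) (λ B → IsPartition B × PartitionSatisfies B φ)

-- For a model M of Φ, classify the elements of U = ⋃ₓ M x by their membership
-- pattern in Fin n → Bool. Elements with the same pattern form a Venn region;
-- regions with distinct patterns are disjoint, only the 2ⁿ − 1 patterns with a true
-- entry occur, and M x is the union of the regions whose pattern is true at x.
-- Replacing each empty region by the singleton of a fresh set outside U (Russell
-- sets of an increasing chain) yields a partition with exactly 2ⁿ − 1 blocks.
-- Conversely, the assignment induced by a partition is itself a model.
module Submission where

open import Defs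
open import Level using (0ℓ)
open import Data.Nat using (ℕ; zero; suc; _^_; _∸_; _<_; _≤′_; ≤′-refl; ≤′-step)
open import Data.Nat.Properties using (suc-pred; m^n≢0; <-cmp; ≤⇒≤′; z≤′n)
import Data.Fin as Fin
open import Data.Fin using (Fin; toℕ; punchIn; punchOut; finToFun; funToFin; combine)
open import Data.Fin.Properties
  using (2↔Bool; funToFin-finToFin; finToFun-funToFin; punchIn-injective; punchIn-punchOut; toℕ-injective)
open import Data.Bool using (Bool; true; false; T)
open import Data.Unit using (⊤; tt)
open import Data.Sum using (inj₁; inj₂)
open import Data.Product using (Σ; ∃; _×_; _,_; proj₁; proj₂)
open import Function using (_∘_; Inverse; mk⇔)
open import Relation.Nullary using (¬_; Dec; yes; no; contradiction)
open import Relation.Nullary.Decidable using (isYes; toWitness; fromWitness; isYes≗does; does-⇔)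
open import Relation.Binary using (tri<; tri≈; tri>)
open import Relation.Binary.PropositionalEquality
open import Relation.Binary.PropositionalEquality.Properties using (subst-sym-subst; subst-subst-sym)
open import Axiom.ExcludedMiddle using (ExcludedMiddle)

open ≡-Reasoning

Pattern : ℕ → Set
Pattern n = Fin n → Bool

funToFin-cong : ∀ {m k} {f g : Fin m → Fin k} → f ≗ g → funToFin f ≡ funToFin g
funToFin-cong {zero}  _   = refl
funToFin-cong {suc m} f≗g = cong₂ combine (f≗g Fin.zero) (funToFin-cong (f≗g ∘ Fin.suc))

module _ {n : ℕ} where

  open Inverse 2↔Bool using (to; from; strictlyInverseˡ; strictlyInverseʳ)

  private
    2^n≡1+[2^n∸1] : 2 ^ n ≡ suc (2 ^ n ∸ 1)
    2^n≡1+[2^n∸1] = sym (suc-pred (2 ^ n) {{m^n≢0 2 n}})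

    digits : Fin (2 ^ n) → Fin n → Fin 2
    digits = finToFun

  encode : Pattern n → Fin (suc (2 ^ n ∸ 1))
  encode f = subst Fin 2^n≡1+[2^n∸1] (funToFin (from ∘ f))

  decode : Fin (suc (2 ^ n ∸ 1)) → Pattern n
  decode i = to ∘ digits (subst Fin (sym 2^n≡1+[2^n∸1]) i)

  encode-cong : {f g : Pattern n} → f ≗ g → encode f ≡ encode g
  encode-cong f≗g = cong (subst Fin 2^n≡1+[2^n∸1]) (funToFin-cong (cong from ∘ f≗g))

  decode-encode : ∀ f → decode (encode f) ≗ f
  decode-encode f x = begin
    to (digits (subst Fin (sym 2^n≡1+[2^n∸1]) (subst Fin 2^n≡1+[2^n∸1] c)) x)
      ≡⟨ cong (λ i → to (digits i x)) (subst-sym-subst 2^n≡1+[2^n∸1]) ⟩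
    to (digits c x)
      ≡⟨ cong to (finToFun-funToFin (from ∘ f) x) ⟩
    to (from (f x))
      ≡⟨ strictlyInverseˡ (f x) ⟩
    f x ∎
    where
    c : Fin (2 ^ n)
    c = funToFin (from ∘ f)

  encode-decode : ∀ i → encode (decode i) ≡ i
  encode-decode i = begin
    subst Fin 2^n≡1+[2^n∸1] (funToFin (from ∘ to ∘ digits j))
      ≡⟨ cong (subst Fin 2^n≡1+[2^n∸1]) (funToFin-cong (strictlyInverseʳ ∘ digits j)) ⟩
    subst Fin 2^n≡1+[2^n∸1] (funToFin (digits j))
      ≡⟨ cong (subst Fin 2^n≡1+[2^n∸1]) (funToFin-finToFin {n} j) ⟩
    subst Fin 2^n≡1+[2^n∸1] j
      ≡⟨ subst-subst-sym 2^n≡1+[2^n∸1] ⟩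
    i ∎
    where
    j : Fin (2 ^ n)
    j = subst Fin (sym 2^n≡1+[2^n∸1]) i

  decode-injective : ∀ {i j} → decode i ≗ decode j → i ≡ j
  decode-injective {i} {j} h = begin
    i                 ≡⟨ sym (encode-decode i) ⟩
    encode (decode i) ≡⟨ encode-cong h ⟩
    encode (decode j) ≡⟨ encode-decode j ⟩
    j                 ∎

  -- The patterns with a true entry, enumerated by skipping the code of the all-false one.
  regionPattern : Fin (2 ^ n ∸ 1) → Pattern n
  regionPattern = decode ∘ punchIn (encode (λ _ → false))

  regionPattern-injective : ∀ {b c} → regionPattern b ≗ regionPattern c → b ≡ c
  regionPattern-injective = punchIn-injective _ _ _ ∘ decode-injective

  regionPattern-surjective : (f : Pattern n) (x : Fin n) → T (f x) → ∃ λ b → regionPattern b ≗ f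
  regionPattern-surjective f x fx = punchOut codes≢ , λ y → begin
    decode (punchIn (encode (λ _ → false)) (punchOut codes≢)) y
      ≡⟨ cong (λ i → decode i y) (punchIn-punchOut codes≢) ⟩
    decode (encode f) y
      ≡⟨ decode-encode f y ⟩
    f y ∎
    where
    codes≢ : encode (λ _ → false) ≢ encode f
    codes≢ eq = subst T (begin
      f x                             ≡⟨ sym (decode-encode f x) ⟩
      decode (encode f) x             ≡⟨ cong (λ i → decode i x) (sym eq) ⟩
      decode (encode (λ _ → false)) x ≡⟨ decode-encode (λ _ → false) x ⟩
      false                           ∎) fx

≐-refl : ∀ {x} → x ≐ x
≐-refl {sup A f} = (λ a → a , ≐-refl) , (λ a → a , ≐-refl)

≐-sym : ∀ {x y} → x ≐ y → y ≐ x
≐-sym {sup A f} {sup B g} (p , q) =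
  (λ b → proj₁ (q b) , ≐-sym (proj₂ (q b))) , (λ a → proj₁ (p a) , ≐-sym (proj₂ (p a)))

≐-trans : ∀ {x y z} → x ≐ y → y ≐ z → x ≐ z
≐-trans {sup A f} {sup B g} {sup C h} (p , q) (p′ , q′) =
  (λ a → proj₁ (p′ (proj₁ (p a))) , ≐-trans (proj₂ (p a)) (proj₂ (p′ (proj₁ (p a))))) ,
  (λ c → proj₁ (q (proj₁ (q′ c))) , ≐-trans (proj₂ (q (proj₁ (q′ c)))) (proj₂ (q′ c)))

⊆-refl : ∀ {x} → x ⊆V x
⊆-refl i = i , ≐-refl

≐⇒⊆ : ∀ {x y} → x ≐ y → x ⊆V y
≐⇒⊆ {sup A f} {sup B g} (p , _) = p

≐⇒⊇ : ∀ {x y} → x ≐ y → y ⊆V x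
≐⇒⊇ = ≐⇒⊆ ∘ ≐-sym

≐-intro : ∀ {x y} → x ⊆V y → y ⊆V x → x ≐ y
≐-intro {sup A f} {sup B g} s t = s , λ b → proj₁ (t b) , ≐-sym (proj₂ (t b))

∈-respˡ : ∀ {x y} z → x ≐ y → x ∈V z → y ∈V z
∈-respˡ z x≐y (i , e) = i , ≐-trans (≐-sym x≐y) e

∈-resp-⊆ : ∀ {x y z} → x ∈V y → y ⊆V z → x ∈V z
∈-resp-⊆ (j , e) s = proj₁ (s j) , ≐-trans e (proj₂ (s j))

∈-respʳ : ∀ {x y z} → y ≐ z → x ∈V y → x ∈V z
∈-respʳ {y = y} {z} y≐z m = ∈-resp-⊆ {y = y} {z} m (≐⇒⊆ y≐z)

⊆-trans : ∀ {x y z} → x ⊆V y → y ⊆V z → x ⊆V z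
⊆-trans {y = y} {z} s t i = ∈-resp-⊆ {y = y} {z} (s i) t

∪-mono : ∀ {Y Y′ Z Z′} → Y ⊆V Y′ → Z ⊆V Z′ → (Y ∪V Z) ⊆V (Y′ ∪V Z′)
∪-mono s t (inj₁ i) = inj₁ (proj₁ (s i)) , proj₂ (s i)
∪-mono s t (inj₂ i) = inj₂ (proj₁ (t i)) , proj₂ (t i)

∩-mono : ∀ {Y Y′ Z Z′} → Y ⊆V Y′ → Z ⊆V Z′ → (Y ∩V Z) ⊆V (Y′ ∩V Z′)
∩-mono {Z = Z} {Z′} s t (i , m) =
  (proj₁ (s i) , ∈-respˡ Z′ (proj₂ (s i)) (∈-resp-⊆ {y = Z} {Z′} m t)) , proj₂ (s i)

∖-mono : ∀ {Y Y′ Z Z′} → Y ⊆V Y′ → Z′ ⊆V Z → (Y ∖V Z) ⊆V (Y′ ∖V Z′)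
∖-mono {Z = Z} {Z′} s t (i , m) =
  (proj₁ (s i) , λ m′ → m (∈-respˡ Z (≐-sym (proj₂ (s i))) (∈-resp-⊆ {y = Z′} {Z} m′ t))) , proj₂ (s i)

upair-cong : ∀ {u u′ v v′} → u ≐ u′ → v ≐ v′ → upair u v ≐ upair u′ v′
upair-cong u≐u′ v≐v′ =
  ≐-intro (λ { true → true , u≐u′ ; false → false , v≐v′ })
          (λ { true → true , ≐-sym u≐u′ ; false → false , ≐-sym v≐v′ })

⊗-mono : ∀ {Y Y′ Z Z′} → Y ⊆V Y′ → Z ⊆V Z′ → (Y ⊗V Z) ⊆V (Y′ ⊗V Z′)
⊗-mono s t (i , j) = (proj₁ (s i) , proj₁ (t j)) , upair-cong (proj₂ (s i)) (proj₂ (t j))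

Congruent₂ : (V → V → V) → Set₁
Congruent₂ _∙_ = ∀ {Y Y′ Z Z′} → Y ≐ Y′ → Z ≐ Z′ → (Y ∙ Z) ≐ (Y′ ∙ Z′)

∪-cong : Congruent₂ _∪V_
∪-cong {Y} {Y′} {Z} {Z′} Y≐Y′ Z≐Z′ = ≐-intro {Y ∪V Z} {Y′ ∪V Z′}
  (∪-mono {Y} {Y′} {Z} {Z′} (≐⇒⊆ Y≐Y′) (≐⇒⊆ Z≐Z′))
  (∪-mono {Y′} {Y} {Z′} {Z} (≐⇒⊇ Y≐Y′) (≐⇒⊇ Z≐Z′))

∩-cong : Congruent₂ _∩V_
∩-cong {Y} {Y′} {Z} {Z′} Y≐Y′ Z≐Z′ = ≐-intro {Y ∩V Z} {Y′ ∩V Z′}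
  (∩-mono {Y} {Y′} {Z} {Z′} (≐⇒⊆ Y≐Y′) (≐⇒⊆ Z≐Z′))
  (∩-mono {Y′} {Y} {Z′} {Z} (≐⇒⊇ Y≐Y′) (≐⇒⊇ Z≐Z′))

∖-cong : Congruent₂ _∖V_
∖-cong {Y} {Y′} {Z} {Z′} Y≐Y′ Z≐Z′ = ≐-intro {Y ∖V Z} {Y′ ∖V Z′}
  (∖-mono {Y} {Y′} {Z} {Z′} (≐⇒⊆ Y≐Y′) (≐⇒⊇ Z≐Z′))
  (∖-mono {Y′} {Y} {Z′} {Z} (≐⇒⊇ Y≐Y′) (≐⇒⊆ Z≐Z′))

⊗-cong : Congruent₂ _⊗V_
⊗-cong {Y} {Y′} {Z} {Z′} Y≐Y′ Z≐Z′ = ≐-intro {Y ⊗V Z} {Y′ ⊗V Z′}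
  (⊗-mono {Y} {Y′} {Z} {Z′} (≐⇒⊆ Y≐Y′) (≐⇒⊆ Z≐Z′))
  (⊗-mono {Y′} {Y} {Z′} {Z} (≐⇒⊇ Y≐Y′) (≐⇒⊇ Z≐Z′))

≐-resp-op : ∀ {_∙_} → Congruent₂ _∙_ → ∀ {X X′ Y Y′ Z Z′} →
            X ≐ X′ → Y ≐ Y′ → Z ≐ Z′ → X ≐ (Y ∙ Z) → X′ ≐ (Y′ ∙ Z′)
≐-resp-op ∙-cong X≐X′ Y≐Y′ Z≐Z′ e = ≐-trans (≐-sym X≐X′) (≐-trans e (∙-cong Y≐Y′ Z≐Z′))

⊆-resp-≐ : ∀ {X X′ Y Y′} → X ≐ X′ → Y ≐ Y′ → X ⊆V Y → X′ ⊆V Y′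
⊆-resp-≐ {X} {X′} {Y} {Y′} X≐X′ Y≐Y′ s = ⊆-trans {X′} {X} {Y′} (≐⇒⊇ X≐X′) (⊆-trans {X} {Y} {Y′} s (≐⇒⊆ Y≐Y′))

module _ {n : ℕ} {M M′ : Fin n → V} (M≐M′ : ∀ v → M v ≐ M′ v) where

  ⟦⟧A-resp-≐ : (a : Atom n) → ⟦ a ⟧A M → ⟦ a ⟧A M′
  ⟦⟧A-resp-≐ (∪-atom x y z) = ≐-resp-op ∪-cong (M≐M′ x) (M≐M′ y) (M≐M′ z)
  ⟦⟧A-resp-≐ (∩-atom x y z) = ≐-resp-op ∩-cong (M≐M′ x) (M≐M′ y) (M≐M′ z)
  ⟦⟧A-resp-≐ (∖-atom x y z) = ≐-resp-op ∖-cong (M≐M′ x) (M≐M′ y) (M≐M′ z)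
  ⟦⟧A-resp-≐ (⊗-atom x y z) = ≐-resp-op ⊗-cong (M≐M′ x) (M≐M′ y) (M≐M′ z)
  ⟦⟧A-resp-≐ (⊆-atom x y)   = ⊆-resp-≐ (M≐M′ x) (M≐M′ y)

⟦⟧-resp-≐ : ∀ {n} {M M′ : Fin n → V} → (∀ v → M v ≐ M′ v) → (φ : Formula n) → ⟦ φ ⟧ M → ⟦ φ ⟧ M′
⟦⟧-resp-≐ M≐M′ (atom a)   = ⟦⟧A-resp-≐ M≐M′ a
⟦⟧-resp-≐ M≐M′ (neg φ)    = λ ¬s s′ → ¬s (⟦⟧-resp-≐ (≐-sym ∘ M≐M′) φ s′)
⟦⟧-resp-≐ M≐M′ (conj φ ψ) = λ (s , t) → ⟦⟧-resp-≐ M≐M′ φ s , ⟦⟧-resp-≐ M≐M′ ψ t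
⟦⟧-resp-≐ M≐M′ (disj φ ψ) = λ { (inj₁ s) → inj₁ (⟦⟧-resp-≐ M≐M′ φ s)
                              ; (inj₂ t) → inj₂ (⟦⟧-resp-≐ M≐M′ ψ t) }

russell : V → V
russell X = sup (Σ (Idx X) (λ a → ¬ (elt X a ∈V elt X a))) (λ q → elt X (proj₁ q))

∈-russell⇒∉-self : ∀ {X z} → z ∈V russell X → ¬ (z ∈V z)
∈-russell⇒∉-self {X} {z} ((a , ¬aa) , z≐a) zz = ¬aa (∈-respʳ z≐a (∈-respˡ z z≐a zz))

∉-self⇒∈-russell : ∀ {X z} → z ∈V X → ¬ (z ∈V z) → z ∈V russell X
∉-self⇒∈-russell {X} {z} (a , z≐a) ¬zz =
  (a , λ aa → ¬zz (∈-respʳ (≐-sym z≐a) (∈-respˡ (elt X a) (≐-sym z≐a) aa))) , z≐a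

russell-∉ : ∀ X → ¬ (russell X ∈V X)
russell-∉ X m = ¬RR (∉-self⇒∈-russell {X} m ¬RR)
  where
  ¬RR : ¬ (russell X ∈V russell X)
  ¬RR RR = ∈-russell⇒∉-self {X} RR RR

singleton : V → V
singleton x = sup ⊤ (λ _ → x)

extend : V → ℕ → V
extend U zero    = U
extend U (suc k) = extend U k ∪V singleton (russell (extend U k))

fresh : V → ℕ → V
fresh U k = russell (extend U k)

extend-step : ∀ U k → extend U k ⊆V extend U (suc k)
extend-step U k i = inj₁ i , ≐-refl

extend-mono : ∀ U {j k} → j ≤′ k → extend U j ⊆V extend U k
extend-mono U {j} ≤′-refl            = ⊆-refl {extend U j}
extend-mono U {j} (≤′-step {k} j≤k) =
  ⊆-trans {extend U j} {extend U k} {extend U (suc k)} (extend-mono U j≤k) (extend-step U k)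

fresh-∉ : ∀ U k → ¬ (fresh U k ∈V U)
fresh-∉ U k m = russell-∉ (extend U k) (∈-resp-⊆ {y = U} {extend U k} m (extend-mono U {0} {k} z≤′n))

fresh-∈-extend : ∀ U k → fresh U k ∈V extend U (suc k)
fresh-∈-extend U k = inj₂ tt , ≐-refl

fresh-distinct : ∀ U {j k} → j < k → ¬ (fresh U j ≐ fresh U k)
fresh-distinct U {j} {k} j<k e =
  russell-∉ (extend U k) (∈-respˡ (extend U k) e fresh-j∈extend-k)
  where
  fresh-j∈extend-k : fresh U j ∈V extend U k
  fresh-j∈extend-k =
    ∈-resp-⊆ {y = extend U (suc j)} {extend U k} (fresh-∈-extend U j) (extend-mono U (≤⇒≤′ j<k))

fresh-injective : ∀ U {j k} → fresh U j ≐ fresh U k → j ≡ k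
fresh-injective U {j} {k} e with <-cmp j k
... | tri< j<k _ _ = contradiction e (fresh-distinct U j<k)
... | tri≈ _ j≡k _ = j≡k
... | tri> _ _ k<j = contradiction (≐-sym e) (fresh-distinct U k<j)

module VennPartition (em : ExcludedMiddle 0ℓ) {n : ℕ} (M : Fin n → V) where

  U : V
  U = sup (Σ (Fin n) (Idx ∘ M)) (λ p → elt (M (proj₁ p)) (proj₂ p))

  venn : V → Pattern n
  venn u x = isYes (em {u ∈V M x})

  venn-sound : ∀ {u x} → T (venn u x) → u ∈V M x
  venn-sound = toWitness

  venn-complete : ∀ {u x} → u ∈V M x → T (venn u x)
  venn-complete = fromWitness

  venn-cong : ∀ {u w} → u ≐ w → venn u ≗ venn w
  venn-cong {u} {w} u≐w x = begin
    isYes (em {u ∈V M x}) ≡⟨ isYes≗does em ⟩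
    _                     ≡⟨ does-⇔ (mk⇔ (∈-respˡ (M x) u≐w) (∈-respˡ (M x) (≐-sym u≐w))) em em ⟩
    _                     ≡⟨ isYes≗does em ⟨
    isYes (em {w ∈V M x}) ∎

  region : Fin (2 ^ n ∸ 1) → V
  region b = sup (Σ (Idx U) (λ p → regionPattern b ≗ venn (elt U p))) (λ q → elt U (proj₁ q))

  block : (b : Fin (2 ^ n ∸ 1)) → Dec (Nonempty (region b)) → V
  block b (yes _) = region b
  block b (no _)  = singleton (fresh U (toℕ b))

  membership : Fin n → (b : Fin (2 ^ n ∸ 1)) → Dec (Nonempty (region b)) → Bool
  membership x b (yes _) = regionPattern b x
  membership x b (no _)  = false

  blocks : Fin (2 ^ n ∸ 1) → V
  blocks b = block b em

  𝔍 : Fin n → Fin (2 ^ n ∸ 1) → Bool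
  𝔍 x b = membership x b em

  block-nonempty : ∀ b d → Nonempty (block b d)
  block-nonempty b (yes r) = r
  block-nonempty b (no _)  = tt

  block-disjoint : ∀ {b c} → b ≢ c → ∀ d d′ → Disjoint (block b d) (block c d′)
  block-disjoint b≢c (yes _) (yes _) (p , h) ((p′ , h′) , e) =
    b≢c (regionPattern-injective (λ x → trans (h x) (trans (venn-cong e x) (sym (h′ x)))))
  block-disjoint {c = c} _ (yes _) (no _) (p , _) (tt , e) = fresh-∉ U (toℕ c) (∈-respˡ U e (p , ≐-refl))
  block-disjoint {b} _ (no _) (yes _) tt ((p′ , _) , e)     = fresh-∉ U (toℕ b) (p′ , e)
  block-disjoint b≢c (no _) (no _) tt (tt , e)              = b≢c (toℕ-injective (fresh-injective U e))

  blocks-partition : IsPartition blocks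
  blocks-partition = (λ b → block-nonempty b em) , (λ b c b≢c → block-disjoint b≢c em em)

  into-block : ∀ x a b → regionPattern b ≗ venn (elt (M x) a) → (d : Dec (Nonempty (region b))) →
               Σ (T (membership x b d) × Idx (block b d)) (λ ti → elt (M x) a ≐ elt (block b d) (proj₂ ti))
  into-block x a b h (yes _) = (subst T (sym (h x)) (venn-complete (a , ≐-refl)) , ((x , a) , h)) , ≐-refl
  into-block x a b h (no ∅)  = contradiction ((x , a) , h) ∅

  block-⊆ : ∀ x b d → T (membership x b d) → block b d ⊆V M x
  block-⊆ x b (yes _) t (p , h) = venn-sound (subst T (h x) t)

  M≐⋃blocks : ∀ x → M x ≐ ⋃Sub blocks (𝔍 x)
  M≐⋃blocks x = ≐-intro M⊆ (λ (b , t , i) → block-⊆ x b em t i)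
    where
    M⊆ : M x ⊆V ⋃Sub blocks (𝔍 x)
    M⊆ a with regionPattern-surjective (venn (elt (M x) a)) x (venn-complete (a , ≐-refl))
    ... | b , h with into-block x a b h em
    ...   | (t , i) , e = (b , t , i) , e

satisfiable⇒satByPartition : ExcludedMiddle 0ℓ → ∀ {n} (Φ : Formula n) →
                             Satisfiable Φ → SatByPartitionOfSize (2 ^ n ∸ 1) Φ
satisfiable⇒satByPartition em Φ (M , s) = blocks , blocks-partition , 𝔍 , ⟦⟧-resp-≐ M≐⋃blocks Φ s
  where open VennPartition em M

satByPartition⇒satisfiable : ∀ {n k} (Φ : Formula n) → SatByPartitionOfSize k Φ → Satisfiable Φ
satByPartition⇒satisfiable Φ (B , _ , 𝔍 , s) = (λ v → ⋃Sub B (𝔍 v)) , s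

-- The occurrence hypothesis only identifies n with the number of variables of Φ.
lemma2 : ExcludedMiddle 0ℓ →
    (n : ℕ) (Φ : Formula n) → AllVarsOccur Φ →
    (Satisfiable Φ → SatByPartitionOfSize (2 ^ n ∸ 1) Φ) ×
    (SatByPartitionOfSize (2 ^ n ∸ 1) Φ → Satisfiable Φ)
lemma2 em n Φ _ = satisfiable⇒satByPartition em Φ , satByPartition⇒satisfiable Φ
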